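{- Let $n\ge 4$. If $L=\{1,3\}$, then $f(n,3,4,L)=2^{\binom{n-1}{2}}$.
   Context: $f(n,3,4,L)$ denotes the number of $3$-uniform hypergraphs on the vertex set $[n]=\{1,\ldots,n\}$ such that no set of $4$ vertices spans exactly $i$ edges for any $i\in L$. -}

module Defs where

open import Data.Nat using (ℕ; zero; suc; _≟_)
open import Data.Bool using (true; false)
open import Data.List using (List; []; _∷_; _++_; map; filter; length)
open import Data.List.Relation.Unary.All using (All; all?)
open import Data.List.Membership.DecPropositional _≟_ using (_∉_; _∈?_)
open import Data.Vec using (_∷_; [])
open import Data.Fin.Subset using (Subset; ∣_∣)
open import Data.Fin.Subset.Properties using (_⊆?_)
open import Relation.Nullary using (Dec; ¬?)

allSubsets : (n : ℕ) → List (Subset n)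
allSubsets zero    = [] ∷ []
allSubsets (suc n) = map (false ∷_) (allSubsets n) ++ map (true ∷_) (allSubsets n)

kSets : (k n : ℕ) → List (Subset n)
kSets k n = filter (λ s → ∣ s ∣ ≟ k) (allSubsets n)

sublists : ∀ {a} {A : Set a} → List A → List (List A)
sublists []       = [] ∷ []
sublists (x ∷ xs) = sublists xs ++ map (x ∷_) (sublists xs)

-- A 3-uniform hypergraph on [n] is a set of 3-element subsets of [n];
-- they are enumerated (each exactly once) as the sublists of kSets 3 n.
Hypergraph3 : ℕ → Set
Hypergraph3 n = List (Subset n)

hypergraphs3 : (n : ℕ) → List (Hypergraph3 n)
hypergraphs3 n = sublists (kSets 3 n)

edgesIn : ∀ {n} → Hypergraph3 n → Subset n → ℕ
edgesIn H S = length (filter (_⊆? S) H)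

Avoids : ∀ {n} → List ℕ → Hypergraph3 n → Set
Avoids {n} L H = All (λ S → edgesIn H S ∉ L) (kSets 4 n)

avoids? : ∀ {n} (L : List ℕ) (H : Hypergraph3 n) → Dec (Avoids L H)
avoids? {n} L H = all? (λ S → ¬? (edgesIn H S ∈? L)) (kSets 4 n)

f34 : ℕ → List ℕ → ℕ
f34 n L = length (filter (avoids? L) (hypergraphs3 n))

-- Split off vertex 0: a 3-graph on {0,…,n} is a 3-graph K on the other n
-- vertices together with the link G of vertex 0, a graph on those vertices.
-- A 4-set {0} ∪ T spans e_K(T) + e_G(T) edges with e_K(T) ≤ 1 and
-- e_G(T) ≤ 3, so it avoids {1,3} iff this sum is even, i.e. iff T ∈ K
-- exactly when e_G(T) is odd.  Thus G determines K.  Conversely, for that K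
-- every 4-set S ⊆ {1,…,n} spans
--   Σ_{T ⊂ S, |T| = 3} [e_G(T) odd] ≡ Σ_T e_G(T) = Σ_{g ∈ G, g ⊆ S} 2 ≡ 0 (mod 2)
-- edges, since each pair g ⊆ S lies in exactly two triples T ⊂ S.  Hence each
-- of the 2^(n C 2) graphs G extends in exactly one way.
module Submission where

open import Defs
open import Data.Nat using (ℕ; _≤_; _∸_; _^_)
open import Data.Nat.Combinatorics using (_C_)
open import Data.List using (_∷_; [])
open import Relation.Binary.PropositionalEquality using (_≡_)

open import Data.Bool using (true; false; if_then_else_; _∧_)
open import Data.Empty using (⊥-elim)
open import Data.Fin.Subset using (Subset; ∣_∣; outside; inside; _⊆_) renaming (⊥ to ∅; ⊤ to full)
open import Data.Fin.Subset.Properties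
  using (_⊆?_; drop-∷-⊆; p⊆q⇒∣p∣≤∣q∣; ⊆-refl; ⊆-trans; ⊆-min; ⊆-max; ∣⊥∣≡0; ∣⊤∣≡n)
open import Data.List using (List; _++_; map; filter; length)
open import Data.List.Membership.Propositional using (_∈_; _∉_; lose; find)
open import Data.List.Membership.Propositional.Properties using (∈-filter⁺; ∈-filter⁻; ∈-++⁻; ∈-map⁻)
open import Data.List.Properties
  using ( length-++; length-map; map-cong; map-++; map-∘; ∷-injectiveʳ
        ; filter-++; filter-≐; filter-all; filter-none; filter-some; filter-accept; filter-reject)
open import Data.List.Relation.Binary.Sublist.Propositional using ([]; _∷_; _∷ʳ_) renaming (_⊆_ to _⊑_)
open import Data.List.Relation.Binary.Sublist.Propositional.Properties using (filter⁺; length-mono-≤; Any-resp-⊆)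
open import Data.List.Relation.Unary.All as All using (All)
open import Data.List.Relation.Unary.All.Properties using (All¬⇒¬Any; ¬Any⇒All¬; ++⁺; ++⁻; map⁺; map⁻)
open import Data.List.Relation.Unary.AllPairs using ([]; _∷_)
open import Data.List.Relation.Unary.Any using (here; there; any?)
open import Data.List.Relation.Unary.Unique.Propositional using (Unique)
import Data.List.Relation.Unary.Unique.Propositional.Properties as Unique
open import Data.Nat using (zero; suc; _+_; _*_; _%_; _≟_; _<_; s≤s; NonZero)
open import Data.Nat.Combinatorics using (nCn≡1; nCk+nC[k+1]≡[n+1]C[k+1])
open import Data.Nat.DivMod using (%-distribˡ-+; m%n%n≡m%n)
open import Data.Nat.ListAction using (sum)
open import Data.Nat.Properties
  using ( +-comm; +-identityʳ; +-suc; +-∸-assoc; *-zeroʳ; *-identityʳ; +-commutativeSemigroup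
        ; suc-injective; <⇒≢; ≤⇒≯; ≤-antisym; ≤-refl; ≤-trans; ≤-reflexive)
open import Algebra.Properties.CommutativeSemigroup +-commutativeSemigroup using (interchange)
open import Data.Product using (_×_; _,_; proj₁; proj₂; swap)
open import Data.Sum using (_⊎_; inj₁; inj₂)
open import Data.Vec using ([]; _∷_)
open import Data.Vec.Base using (here)
import Data.Vec.Properties as Vec
open import Function using (_∘_)
open import Function.Bundles using (_⇔_; mk⇔; Equivalence)
open import Function.Properties.Equivalence using () renaming (trans to ⇔-trans)
open import Level using (Level)
open import Relation.Binary.PropositionalEquality
  using (refl; sym; trans; cong; cong₂; subst; subst₂; module ≡-Reasoning)
open import Relation.Nullary using (Dec; does; yes; no; ¬_; contradiction)
open import Relation.Nullary.Decidable using (_×-dec_)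
open import Relation.Unary using (Pred; Decidable; _≐_; ∁)

private
  variable
    a b p q : Level
    A : Set a
    B : Set b

count : {P : Pred A p} → Decidable P → List A → ℕ
count P? xs = length (filter P? xs)

indicator : {P : Set p} → Dec P → ℕ
indicator P? = if does P? then 1 else 0

module _ {P : Pred A p} (P? : Decidable P) where

  count-∷ : ∀ x xs → count P? (x ∷ xs) ≡ indicator (P? x) + count P? xs
  count-∷ x xs with does (P? x)
  ... | true  = refl
  ... | false = refl

  count-++ : ∀ xs ys → count P? (xs ++ ys) ≡ count P? xs + count P? ys
  count-++ xs ys = trans (cong length (filter-++ P? xs ys)) (length-++ (filter P? xs))

  filter-map : (f : B → A) (xs : List B) → filter P? (map f xs) ≡ map f (filter (λ y → P? (f y)) xs)
  filter-map f []       = refl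
  filter-map f (x ∷ xs) with does (P? (f x))
  ... | true  = cong (f x ∷_) (filter-map f xs)
  ... | false = filter-map f xs

  count-map : (f : B → A) (xs : List B) → count P? (map f xs) ≡ count (λ y → P? (f y)) xs
  count-map f xs = trans (cong length (filter-map f xs)) (length-map f (filter (λ y → P? (f y)) xs))

  count-none : ∀ {xs} → All (∁ P) xs → count P? xs ≡ 0
  count-none ¬Pxs = cong length (filter-none P? ¬Pxs)

  count≡sum : ∀ xs → count P? xs ≡ sum (map (λ x → indicator (P? x)) xs)
  count≡sum []       = refl
  count≡sum (x ∷ xs) = trans (count-∷ x xs) (cong (indicator (P? x) +_) (count≡sum xs))

  count-mono : ∀ {xs ys} → xs ⊑ ys → count P? xs ≤ count P? ys
  count-mono xs⊑ys = length-mono-≤ (filter⁺ P? P? (λ { refl Px → Px }) xs⊑ys)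

module _ {P : Pred A p} {Q : Pred A q} (P? : Decidable P) (Q? : Decidable Q) where

  count-cong : (∀ x → does (P? x) ≡ does (Q? x)) → ∀ xs → count P? xs ≡ count Q? xs
  count-cong h []       = refl
  count-cong h (x ∷ xs) = begin
    count P? (x ∷ xs)                     ≡⟨ count-∷ P? x xs ⟩
    indicator (P? x) + count P? xs        ≡⟨ cong₂ (λ b n → (if b then 1 else 0) + n) (h x) (count-cong h xs) ⟩
    indicator (Q? x) + count Q? xs        ≡⟨ count-∷ Q? x xs ⟨
    count Q? (x ∷ xs)                     ∎
    where open ≡-Reasoning

  count-≐ : P ≐ Q → ∀ xs → count P? xs ≡ count Q? xs
  count-≐ P≐Q xs = cong length (filter-≐ P? Q? P≐Q xs)

  count-filter : ∀ xs → count Q? (filter P? xs) ≡ count (λ x → P? x ×-dec Q? x) xs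
  count-filter []       = refl
  count-filter (x ∷ xs) with does (P? x)
  ... | false = count-filter xs
  ... | true with does (Q? x)
  ...   | true  = cong suc (count-filter xs)
  ...   | false = count-filter xs

sum-map-const : ∀ (f : A → ℕ) {c xs} → All (λ x → f x ≡ c) xs → sum (map f xs) ≡ length xs * c
sum-map-const f All.[]         = refl
sum-map-const f (fx≡c All.∷ h) = cong₂ _+_ fx≡c (sum-map-const f h)

sum-map-+ : ∀ (f g : A → ℕ) xs → sum (map (λ x → f x + g x) xs) ≡ sum (map f xs) + sum (map g xs)
sum-map-+ f g []       = refl
sum-map-+ f g (x ∷ xs) = trans (cong (f x + g x +_) (sum-map-+ f g xs)) (interchange (f x) (g x) _ _)

sum-map-% : ∀ (f : A → ℕ) d .{{_ : NonZero d}} xs → sum (map (λ x → f x % d) xs) % d ≡ sum (map f xs) % d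
sum-map-% f d []       = refl
sum-map-% f d (x ∷ xs) = begin
  (f x % d + sum (map (λ x → f x % d) xs)) % d       ≡⟨ %-distribˡ-+ (f x % d) _ d ⟩
  (f x % d % d + sum (map (λ x → f x % d) xs) % d) % d ≡⟨ cong₂ (λ u v → (u + v) % d) (m%n%n≡m%n (f x) d) (sum-map-% f d xs) ⟩
  (f x % d + sum (map f xs) % d) % d                   ≡⟨ %-distribˡ-+ (f x) _ d ⟨
  (f x + sum (map f xs)) % d                           ∎
  where open ≡-Reasoning

sum-count-comm : ∀ {r} {R : A → B → Set r} (R? : ∀ x y → Dec (R x y)) xs ys →
                 sum (map (λ x → count (R? x) ys) xs) ≡ sum (map (λ y → count (λ x → R? x y) xs) ys)
sum-count-comm R? []       ys = sym (trans (sum-map-const (λ _ → 0) (All.universal (λ _ → refl) ys)) (*-zeroʳ (length ys)))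
sum-count-comm R? (x ∷ xs) ys = begin
  count (R? x) ys + sum (map (λ x′ → count (R? x′) ys) xs)
    ≡⟨ cong₂ _+_ (count≡sum (R? x) ys) (sum-count-comm R? xs ys) ⟩
  sum (map (λ y → indicator (R? x y)) ys) + sum (map (λ y → count (λ x′ → R? x′ y) xs) ys)
    ≡⟨ sum-map-+ (λ y → indicator (R? x y)) (λ y → count (λ x′ → R? x′ y) xs) ys ⟨
  sum (map (λ y → indicator (R? x y) + count (λ x′ → R? x′ y) xs) ys)
    ≡⟨ cong sum (map-cong (λ y → count-∷ (λ x′ → R? x′ y) x xs) ys) ⟨
  sum (map (λ y → count (λ x′ → R? x′ y) (x ∷ xs)) ys)
    ∎
  where open ≡-Reasoning

indicator-odd : ∀ n → indicator (n % 2 ≟ 1) ≡ n % 2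
indicator-odd 0             = refl
indicator-odd 1             = refl
indicator-odd (suc (suc n)) = indicator-odd n

count-odd-%2 : ∀ (f : A → ℕ) xs → count (λ x → f x % 2 ≟ 1) xs % 2 ≡ sum (map f xs) % 2
count-odd-%2 f xs = begin
  count (λ x → f x % 2 ≟ 1) xs % 2                   ≡⟨ cong (_% 2) (count≡sum (λ x → f x % 2 ≟ 1) xs) ⟩
  sum (map (λ x → indicator (f x % 2 ≟ 1)) xs) % 2 ≡⟨ cong (λ ys → sum ys % 2) (map-cong (indicator-odd ∘ f) xs) ⟩
  sum (map (λ x → f x % 2) xs) % 2                   ≡⟨ sum-map-% f 2 xs ⟩
  sum (map f xs) % 2                                 ∎
  where open ≡-Reasoning

sum-even : ∀ (f : A → ℕ) {xs} → All (λ x → f x % 2 ≡ 0) xs → sum (map f xs) % 2 ≡ 0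
sum-even f {xs} h = begin
  sum (map f xs) % 2                 ≡⟨ sum-map-% f 2 xs ⟨
  sum (map (λ x → f x % 2) xs) % 2 ≡⟨ cong (_% 2) (sum-map-const (λ x → f x % 2) h) ⟩
  length xs * 0 % 2                  ≡⟨ cong (_% 2) (*-zeroʳ (length xs)) ⟩
  0                                  ∎
  where open ≡-Reasoning

sublists-map : ∀ (f : A → B) xs → sublists (map f xs) ≡ map (map f) (sublists xs)
sublists-map f []       = refl
sublists-map f (x ∷ xs) = begin
  sublists (map f xs) ++ map (f x ∷_) (sublists (map f xs))
    ≡⟨ cong (λ S → S ++ map (f x ∷_) S) (sublists-map f xs) ⟩
  map (map f) (sublists xs) ++ map (f x ∷_) (map (map f) (sublists xs))
    ≡⟨ cong (map (map f) (sublists xs) ++_) (trans (sym (map-∘ {g = f x ∷_} {f = map f} (sublists xs))) (map-∘ {g = map f} {f = x ∷_} (sublists xs))) ⟩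
  map (map f) (sublists xs) ++ map (map f) (map (x ∷_) (sublists xs))
    ≡⟨ map-++ (map f) (sublists xs) _ ⟨
  map (map f) (sublists (x ∷ xs))
    ∎
  where open ≡-Reasoning

length-sublists : ∀ (xs : List A) → length (sublists xs) ≡ 2 ^ length xs
length-sublists []       = refl
length-sublists (x ∷ xs) = begin
  length (sublists xs ++ map (x ∷_) (sublists xs))         ≡⟨ length-++ (sublists xs) ⟩
  length (sublists xs) + length (map (x ∷_) (sublists xs)) ≡⟨ cong (length (sublists xs) +_) (length-map (x ∷_) (sublists xs)) ⟩
  length (sublists xs) + length (sublists xs)              ≡⟨ cong (λ n → n + n) (length-sublists xs) ⟩
  2 ^ length xs + 2 ^ length xs                            ≡⟨ cong (2 ^ length xs +_) (+-identityʳ (2 ^ length xs)) ⟨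
  2 ^ length xs + (2 ^ length xs + 0)                      ∎
  where open ≡-Reasoning

∈-sublists⁻ : ∀ {xs ys : List A} → ys ∈ sublists xs → ys ⊑ xs
∈-sublists⁻ {xs = []} (here refl) = []
∈-sublists⁻ {xs = x ∷ xs} ys∈ with ∈-++⁻ (sublists xs) ys∈
... | inj₁ ys∈ˡ = x ∷ʳ ∈-sublists⁻ ys∈ˡ
... | inj₂ ys∈ʳ with ∈-map⁻ (x ∷_) ys∈ʳ
...   | _ , zs∈ , refl = refl ∷ ∈-sublists⁻ zs∈

count-sublists-++ : ∀ {P : Pred (List A) p} (P? : Decidable P) xs ys →
                    count P? (sublists (xs ++ ys)) ≡ sum (map (λ G → count (λ K → P? (K ++ G)) (sublists xs)) (sublists ys))
count-sublists-++ P? []       ys = trans (count≡sum P? (sublists ys))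
  (cong sum (map-cong (λ G → sym (trans (count-∷ (λ K → P? (K ++ G)) [] []) (+-identityʳ (indicator (P? G)))))
                      (sublists ys)))
count-sublists-++ P? (x ∷ xs) ys = begin
  count P? (sublists (xs ++ ys) ++ map (x ∷_) (sublists (xs ++ ys)))
    ≡⟨ count-++ P? (sublists (xs ++ ys)) _ ⟩
  count P? (sublists (xs ++ ys)) + count P? (map (x ∷_) (sublists (xs ++ ys)))
    ≡⟨ cong (count P? (sublists (xs ++ ys)) +_) (count-map P? (x ∷_) (sublists (xs ++ ys))) ⟩
  count P? (sublists (xs ++ ys)) + count (λ K → P? (x ∷ K)) (sublists (xs ++ ys))
    ≡⟨ cong₂ _+_ (count-sublists-++ P? xs ys) (count-sublists-++ (λ K → P? (x ∷ K)) xs ys) ⟩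
  sum (map (λ G → count (λ K → P? (K ++ G)) (sublists xs)) (sublists ys))
    + sum (map (λ G → count (λ K → P? (x ∷ K ++ G)) (sublists xs)) (sublists ys))
    ≡⟨ sum-map-+ (λ G → count (λ K → P? (K ++ G)) (sublists xs)) _ (sublists ys) ⟨
  sum (map (λ G → count (λ K → P? (K ++ G)) (sublists xs) + count (λ K → P? (x ∷ K ++ G)) (sublists xs)) (sublists ys))
    ≡⟨ cong sum (map-cong count-∷-sublists (sublists ys)) ⟩
  sum (map (λ G → count (λ K → P? (K ++ G)) (sublists (x ∷ xs))) (sublists ys))
    ∎
  where
  open ≡-Reasoning
  count-∷-sublists : ∀ G → count (λ K → P? (K ++ G)) (sublists xs) + count (λ K → P? (x ∷ K ++ G)) (sublists xs)
                         ≡ count (λ K → P? (K ++ G)) (sublists (x ∷ xs))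
  count-∷-sublists G = sym (trans (count-++ (λ K → P? (K ++ G)) (sublists xs) _)
    (cong (count (λ K → P? (K ++ G)) (sublists xs) +_) (count-map (λ K → P? (K ++ G)) (x ∷_) (sublists xs))))

⊑-unique⇒≡filter : ∀ {Q : Pred A q} (Q? : Decidable Q) {xs ys} → Unique xs → ys ⊑ xs →
                   (∀ {x} → x ∈ xs → x ∈ ys ⇔ Q x) → ys ≡ filter Q? xs
⊑-unique⇒≡filter Q? []                   []        h = refl
⊑-unique⇒≡filter {Q = Q} Q? (x∉xs ∷ uxs) (x ∷ʳ ys⊑xs) h =
  trans (⊑-unique⇒≡filter Q? uxs ys⊑xs (h ∘ there)) (sym (filter-reject Q? ¬Qx))
  where
  ¬Qx : ¬ Q x
  ¬Qx Qx = All¬⇒¬Any x∉xs (Any-resp-⊆ ys⊑xs (Equivalence.from (h (here refl)) Qx))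
⊑-unique⇒≡filter {Q = Q} Q? {x ∷ xs} {x ∷ ys} (x∉xs ∷ uxs) (refl ∷ ys⊑xs) h =
  trans (cong (x ∷_) (⊑-unique⇒≡filter Q? uxs ys⊑xs h′)) (sym (filter-accept Q? (Equivalence.to (h (here refl)) (here refl))))
  where
  h′ : ∀ {y} → y ∈ xs → y ∈ ys ⇔ Q y
  h′ {y} y∈xs = mk⇔ (Equivalence.to (h (there y∈xs)) ∘ there) drop-x
    where
    drop-x : Q y → y ∈ ys
    drop-x Qy with Equivalence.from (h (there y∈xs)) Qy
    ... | here refl  = contradiction y∈xs (All¬⇒¬Any x∉xs)
    ... | there y∈ys = y∈ys

count-sublists≡1 : ∀ {P : Pred (List A) p} (P? : Decidable P) {Q : Pred A q} (Q? : Decidable Q) {xs} → Unique xs →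
                   (∀ {K} → K ⊑ xs → P K ⇔ K ≡ filter Q? xs) → count P? (sublists xs) ≡ 1
count-sublists≡1 P? Q? {[]} [] h with P? []
... | yes _  = refl
... | no ¬P[] = contradiction (Equivalence.from (h []) refl) ¬P[]
count-sublists≡1 P? Q? {x ∷ xs} (x∉xs ∷ uxs) h with Q? x
... | yes Qx = trans (count-++ P? (sublists xs) _) (cong₂ _+_ without-x with-x)
  where
  without-x : count P? (sublists xs) ≡ 0
  without-x = count-none P? (All.tabulate λ K∈ PK →
    All¬⇒¬Any x∉xs (Any-resp-⊆ (∈-sublists⁻ K∈) (subst (x ∈_) (sym (Equivalence.to (h (x ∷ʳ ∈-sublists⁻ K∈)) PK)) (here refl))))
  with-x : count P? (map (x ∷_) (sublists xs)) ≡ 1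
  with-x = trans (count-map P? (x ∷_) (sublists xs)) (count-sublists≡1 (λ K → P? (x ∷ K)) Q? uxs λ K⊑ →
    mk⇔ (∷-injectiveʳ ∘ Equivalence.to (h (refl ∷ K⊑))) (Equivalence.from (h (refl ∷ K⊑)) ∘ cong (x ∷_)))
... | no ¬Qx = trans (count-++ P? (sublists xs) _) (cong₂ _+_ without-x with-x)
  where
  without-x : count P? (sublists xs) ≡ 1
  without-x = count-sublists≡1 P? Q? uxs (h ∘ (x ∷ʳ_))
  with-x : count P? (map (x ∷_) (sublists xs)) ≡ 0
  with-x = trans (count-map P? (x ∷_) (sublists xs)) (count-none (λ K → P? (x ∷ K)) (All.tabulate λ K∈ PxK →
    All¬⇒¬Any x∉xs (proj₁ (∈-filter⁻ Q? (subst (x ∈_) (Equivalence.to (h (refl ∷ ∈-sublists⁻ K∈)) PxK) (here refl))))))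

count-sublists-++-unique-prefix : ∀ {P : Pred (List A) p} (P? : Decidable P) xs ys →
  (∀ {G} → G ∈ sublists ys → count (λ K → P? (K ++ G)) (sublists xs) ≡ 1) →
  count P? (sublists (xs ++ ys)) ≡ 2 ^ length ys
count-sublists-++-unique-prefix P? xs ys h = begin
  count P? (sublists (xs ++ ys))                                            ≡⟨ count-sublists-++ P? xs ys ⟩
  sum (map (λ G → count (λ K → P? (K ++ G)) (sublists xs)) (sublists ys)) ≡⟨ sum-map-const _ (All.tabulate h) ⟩
  length (sublists ys) * 1                                                  ≡⟨ *-identityʳ _ ⟩
  length (sublists ys)                                                      ≡⟨ length-sublists ys ⟩
  2 ^ length ys                                                             ∎
  where open ≡-Reasoning

inside∷⊈outside∷ : ∀ {n} {p q : Subset n} → ¬ (inside ∷ p ⊆ outside ∷ q)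
inside∷⊈outside∷ p⊆q with p⊆q here
... | ()

p⊆q⇒∣p∣≡∣q∣⇒p≡q : ∀ {n} {p q : Subset n} → p ⊆ q → ∣ p ∣ ≡ ∣ q ∣ → p ≡ q
p⊆q⇒∣p∣≡∣q∣⇒p≡q {p = []}          {[]}          _   _ = refl
p⊆q⇒∣p∣≡∣q∣⇒p≡q {p = outside ∷ p} {outside ∷ q} p⊆q e = cong (outside ∷_) (p⊆q⇒∣p∣≡∣q∣⇒p≡q (drop-∷-⊆ p⊆q) e)
p⊆q⇒∣p∣≡∣q∣⇒p≡q {p = outside ∷ p} {inside  ∷ q} p⊆q e = contradiction e (<⇒≢ (s≤s (p⊆q⇒∣p∣≤∣q∣ (drop-∷-⊆ p⊆q))))
p⊆q⇒∣p∣≡∣q∣⇒p≡q {p = inside  ∷ p} {outside ∷ q} p⊆q e = ⊥-elim (inside∷⊈outside∷ p⊆q)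
p⊆q⇒∣p∣≡∣q∣⇒p≡q {p = inside  ∷ p} {inside  ∷ q} p⊆q e =
  cong (inside ∷_) (p⊆q⇒∣p∣≡∣q∣⇒p≡q (drop-∷-⊆ p⊆q) (suc-injective e))

allSubsets-unique : ∀ n → Unique (allSubsets n)
allSubsets-unique zero    = All.[] ∷ []
allSubsets-unique (suc n) = Unique.++⁺ (Unique.map⁺ Vec.∷-injectiveʳ (allSubsets-unique n))
                                       (Unique.map⁺ Vec.∷-injectiveʳ (allSubsets-unique n)) heads-differ
  where
  heads-differ : ∀ {T} → ¬ (T ∈ map (outside ∷_) (allSubsets n) × T ∈ map (inside ∷_) (allSubsets n))
  heads-differ (T∈ₒ , T∈ᵢ) with ∈-map⁻ (outside ∷_) T∈ₒ | ∈-map⁻ (inside ∷_) T∈ᵢ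
  ... | _ , _ , refl | _ , _ , ()

count-allSubsets-suc : ∀ {n} {P : Pred (Subset (suc n)) p} (P? : Decidable P) →
  count P? (allSubsets (suc n)) ≡ count (λ T → P? (outside ∷ T)) (allSubsets n) + count (λ T → P? (inside ∷ T)) (allSubsets n)
count-allSubsets-suc {n = n} P? = trans (count-++ P? (map (outside ∷_) (allSubsets n)) _)
  (cong₂ _+_ (count-map P? (outside ∷_) (allSubsets n)) (count-map P? (inside ∷_) (allSubsets n)))

between? : ∀ {n} (g S : Subset n) (k : ℕ) → Decidable (λ T → ∣ T ∣ ≡ k × g ⊆ T × T ⊆ S)
between? g S k T = ∣ T ∣ ≟ k ×-dec g ⊆? T ×-dec T ⊆? S

-- On subsets with a fixed first coordinate, between? reduces definitionally to
-- its version on the tails.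
module _ {n} (g S : Subset n) where

  count-between-outside-outside : ∀ k →
    count (between? (outside ∷ g) (outside ∷ S) k) (allSubsets (suc n)) ≡ count (between? g S k) (allSubsets n)
  count-between-outside-outside k = begin
    count (between? (outside ∷ g) (outside ∷ S) k) (allSubsets (suc n))
      ≡⟨ count-allSubsets-suc (between? (outside ∷ g) (outside ∷ S) k) ⟩
    count (λ T → between? (outside ∷ g) (outside ∷ S) k (outside ∷ T)) (allSubsets n)
      + count (λ T → between? (outside ∷ g) (outside ∷ S) k (inside ∷ T)) (allSubsets n)
      ≡⟨ cong₂ _+_ (count-cong _ (between? g S k) (λ _ → refl) (allSubsets n))
                   (count-none _ (All.universal (λ _ (_ , _ , T⊆S) → inside∷⊈outside∷ T⊆S) (allSubsets n))) ⟩
    count (between? g S k) (allSubsets n) + 0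
      ≡⟨ +-identityʳ _ ⟩
    count (between? g S k) (allSubsets n)
      ∎
    where open ≡-Reasoning

  count-between-inside-inside : ∀ k →
    count (between? (inside ∷ g) (inside ∷ S) (suc k)) (allSubsets (suc n)) ≡ count (between? g S k) (allSubsets n)
  count-between-inside-inside k = begin
    count (between? (inside ∷ g) (inside ∷ S) (suc k)) (allSubsets (suc n))
      ≡⟨ count-allSubsets-suc (between? (inside ∷ g) (inside ∷ S) (suc k)) ⟩
    count (λ T → between? (inside ∷ g) (inside ∷ S) (suc k) (outside ∷ T)) (allSubsets n)
      + count (λ T → between? (inside ∷ g) (inside ∷ S) (suc k) (inside ∷ T)) (allSubsets n)
      ≡⟨ cong₂ _+_ (count-none _ (All.universal (λ _ (_ , g⊆T , _) → inside∷⊈outside∷ g⊆T) (allSubsets n)))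
                   (count-cong _ (between? g S k) (λ _ → refl) (allSubsets n)) ⟩
    count (between? g S k) (allSubsets n)
      ∎
    where open ≡-Reasoning

  count-between-outside-inside : ∀ k →
    count (between? (outside ∷ g) (inside ∷ S) k) (allSubsets (suc n))
      ≡ count (between? g S k) (allSubsets n) + count (λ T → suc ∣ T ∣ ≟ k ×-dec g ⊆? T ×-dec T ⊆? S) (allSubsets n)
  count-between-outside-inside k = trans (count-allSubsets-suc (between? (outside ∷ g) (inside ∷ S) k))
    (cong₂ _+_ (count-cong _ (between? g S k) (λ _ → refl) (allSubsets n))
               (count-cong _ (λ T → suc ∣ T ∣ ≟ k ×-dec g ⊆? T ×-dec T ⊆? S) (λ _ → refl) (allSubsets n)))

count-between : ∀ {n} {g S : Subset n} → g ⊆ S → ∀ j → count (between? g S (∣ g ∣ + j)) (allSubsets n) ≡ (∣ S ∣ ∸ ∣ g ∣) C j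
count-between {zero} {[]} {[]} _ zero    = refl
count-between {zero} {[]} {[]} _ (suc j) = refl
count-between {suc n} {outside ∷ g} {outside ∷ S} g⊆S j =
  trans (count-between-outside-outside g S (∣ g ∣ + j)) (count-between (drop-∷-⊆ g⊆S) j)
count-between {suc n} {inside ∷ g} {inside ∷ S} g⊆S j =
  trans (count-between-inside-inside g S (∣ g ∣ + j)) (count-between (drop-∷-⊆ g⊆S) j)
count-between {suc n} {inside ∷ g} {outside ∷ S} g⊆S j = ⊥-elim (inside∷⊈outside∷ g⊆S)
count-between {suc n} {outside ∷ g} {inside ∷ S} g⊆S zero = begin
  count (between? (outside ∷ g) (inside ∷ S) (∣ g ∣ + 0)) (allSubsets (suc n))
    ≡⟨ count-between-outside-inside g S (∣ g ∣ + 0) ⟩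
  count (between? g S (∣ g ∣ + 0)) (allSubsets n) + count (λ T → suc ∣ T ∣ ≟ ∣ g ∣ + 0 ×-dec g ⊆? T ×-dec T ⊆? S) (allSubsets n)
    ≡⟨ cong₂ _+_ (count-between (drop-∷-⊆ g⊆S) 0) (count-none _ (All.universal too-large (allSubsets n))) ⟩
  1
    ∎
  where
  open ≡-Reasoning
  too-large : ∀ T → ¬ (suc ∣ T ∣ ≡ ∣ g ∣ + 0 × g ⊆ T × T ⊆ S)
  too-large T (e , g⊆T , _) = ≤⇒≯ (p⊆q⇒∣p∣≤∣q∣ g⊆T) (subst (∣ T ∣ <_) (trans e (+-identityʳ ∣ g ∣)) ≤-refl)
count-between {suc n} {outside ∷ g} {inside ∷ S} g⊆S (suc j) = begin
  count (between? (outside ∷ g) (inside ∷ S) (∣ g ∣ + suc j)) (allSubsets (suc n))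
    ≡⟨ count-between-outside-inside g S (∣ g ∣ + suc j) ⟩
  count (between? g S (∣ g ∣ + suc j)) (allSubsets n) + count (λ T → suc ∣ T ∣ ≟ ∣ g ∣ + suc j ×-dec g ⊆? T ×-dec T ⊆? S) (allSubsets n)
    ≡⟨ cong (count (between? g S (∣ g ∣ + suc j)) (allSubsets n) +_) (count-cong _ (between? g S (∣ g ∣ + j)) one-more (allSubsets n)) ⟩
  count (between? g S (∣ g ∣ + suc j)) (allSubsets n) + count (between? g S (∣ g ∣ + j)) (allSubsets n)
    ≡⟨ cong₂ _+_ (count-between g⊆S′ (suc j)) (count-between g⊆S′ j) ⟩
  (∣ S ∣ ∸ ∣ g ∣) C suc j + (∣ S ∣ ∸ ∣ g ∣) C j
    ≡⟨ +-comm ((∣ S ∣ ∸ ∣ g ∣) C suc j) _ ⟩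
  (∣ S ∣ ∸ ∣ g ∣) C j + (∣ S ∣ ∸ ∣ g ∣) C suc j
    ≡⟨ nCk+nC[k+1]≡[n+1]C[k+1] (∣ S ∣ ∸ ∣ g ∣) j ⟩
  suc (∣ S ∣ ∸ ∣ g ∣) C suc j
    ≡⟨ cong (_C suc j) (+-∸-assoc 1 (p⊆q⇒∣p∣≤∣q∣ g⊆S′)) ⟨
  (suc ∣ S ∣ ∸ ∣ g ∣) C suc j
    ∎
  where
  open ≡-Reasoning
  g⊆S′ = drop-∷-⊆ g⊆S
  one-more : ∀ T → does (suc ∣ T ∣ ≟ ∣ g ∣ + suc j ×-dec g ⊆? T ×-dec T ⊆? S) ≡ does (between? g S (∣ g ∣ + j) T)
  one-more T = cong (λ k → does (suc ∣ T ∣ ≟ k) ∧ does (g ⊆? T ×-dec T ⊆? S)) (+-suc ∣ g ∣ j)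

∈-kSets⁻ : ∀ {k n} {T : Subset n} → T ∈ kSets k n → ∣ T ∣ ≡ k
∈-kSets⁻ {k} {n} T∈ = proj₂ (∈-filter⁻ (λ s → ∣ s ∣ ≟ k) {xs = allSubsets n} T∈)

kSets-unique : ∀ k n → Unique (kSets k n)
kSets-unique k n = Unique.filter⁺ (λ s → ∣ s ∣ ≟ k) (allSubsets-unique n)

kSets-suc : ∀ k n → kSets (suc k) (suc n) ≡ map (outside ∷_) (kSets (suc k) n) ++ map (inside ∷_) (kSets k n)
kSets-suc k n = begin
  filter (λ s → ∣ s ∣ ≟ suc k) (map (outside ∷_) (allSubsets n) ++ map (inside ∷_) (allSubsets n))
    ≡⟨ filter-++ (λ s → ∣ s ∣ ≟ suc k) (map (outside ∷_) (allSubsets n)) _ ⟩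
  filter (λ s → ∣ s ∣ ≟ suc k) (map (outside ∷_) (allSubsets n)) ++ filter (λ s → ∣ s ∣ ≟ suc k) (map (inside ∷_) (allSubsets n))
    ≡⟨ cong₂ _++_ (filter-map (λ s → ∣ s ∣ ≟ suc k) (outside ∷_) (allSubsets n))
                  (filter-map (λ s → ∣ s ∣ ≟ suc k) (inside ∷_) (allSubsets n)) ⟩
  map (outside ∷_) (kSets (suc k) n) ++ map (inside ∷_) (filter (λ s → suc ∣ s ∣ ≟ suc k) (allSubsets n))
    ≡⟨ cong (λ T₂ → map (outside ∷_) (kSets (suc k) n) ++ map (inside ∷_) T₂)
            (filter-≐ (λ s → suc ∣ s ∣ ≟ suc k) (λ s → ∣ s ∣ ≟ k) (suc-injective , cong suc) (allSubsets n)) ⟩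
  map (outside ∷_) (kSets (suc k) n) ++ map (inside ∷_) (kSets k n)
    ∎
  where open ≡-Reasoning

count-kSets-between : ∀ {n} {g S : Subset n} → g ⊆ S → ∀ j →
                      count (g ⊆?_) (filter (_⊆? S) (kSets (∣ g ∣ + j) n)) ≡ (∣ S ∣ ∸ ∣ g ∣) C j
count-kSets-between {n} {g} {S} g⊆S j = begin
  count (g ⊆?_) (filter (_⊆? S) (kSets (∣ g ∣ + j) n))
    ≡⟨ count-filter (_⊆? S) (g ⊆?_) (kSets (∣ g ∣ + j) n) ⟩
  count (λ T → T ⊆? S ×-dec g ⊆? T) (kSets (∣ g ∣ + j) n)
    ≡⟨ count-≐ (λ T → T ⊆? S ×-dec g ⊆? T) (λ T → g ⊆? T ×-dec T ⊆? S) (swap , swap) (kSets (∣ g ∣ + j) n) ⟩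
  count (λ T → g ⊆? T ×-dec T ⊆? S) (kSets (∣ g ∣ + j) n)
    ≡⟨ count-filter (λ T → ∣ T ∣ ≟ ∣ g ∣ + j) (λ T → g ⊆? T ×-dec T ⊆? S) (allSubsets n) ⟩
  count (between? g S (∣ g ∣ + j)) (allSubsets n)
    ≡⟨ count-between g⊆S j ⟩
  (∣ S ∣ ∸ ∣ g ∣) C j
    ∎
  where open ≡-Reasoning

edgesIn-kSets : ∀ k {n} (S : Subset n) → edgesIn (kSets k n) S ≡ ∣ S ∣ C k
edgesIn-kSets k {n} S = begin
  edgesIn (kSets k n) S
    ≡⟨ cong length (filter-all (∅ ⊆?_) (All.universal ⊆-min (filter (_⊆? S) (kSets k n)))) ⟨
  count (∅ ⊆?_) (filter (_⊆? S) (kSets k n))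
    ≡⟨ subst (λ m → count (∅ ⊆?_) (filter (_⊆? S) (kSets (m + k) n)) ≡ (∣ S ∣ ∸ m) C k) (∣⊥∣≡0 n)
             (count-kSets-between (⊆-min S) k) ⟩
  ∣ S ∣ C k
    ∎
  where open ≡-Reasoning

length-kSets : ∀ k n → length (kSets k n) ≡ n C k
length-kSets k n = begin
  length (kSets k n)       ≡⟨ cong length (filter-all (_⊆? full) (All.universal ⊆-max (kSets k n))) ⟨
  edgesIn (kSets k n) full ≡⟨ edgesIn-kSets k (full {n}) ⟩
  ∣ full {n} ∣ C k         ≡⟨ cong (_C k) (∣⊤∣≡n n) ⟩
  n C k                    ∎
  where open ≡-Reasoning

module _ {k n} {K : Hypergraph3 n} (K⊑ : K ⊑ kSets k n) where

  edgesIn-⊑-kSets : ∀ S → edgesIn K S ≤ ∣ S ∣ C k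
  edgesIn-⊑-kSets S = ≤-trans (count-mono (_⊆? S) K⊑) (≤-reflexive (edgesIn-kSets k S))

  edgesIn-self : ∀ {T} → T ∈ K → edgesIn K T ≡ 1
  edgesIn-self {T} T∈K = ≤-antisym
    (≤-trans (edgesIn-⊑-kSets T) (≤-reflexive (trans (cong (_C k) (∈-kSets⁻ (Any-resp-⊆ K⊑ T∈K))) (nCn≡1 k))))
    (filter-some (_⊆? T) (lose T∈K ⊆-refl))

  edgesIn≡0⊎∈ : ∀ {T} → T ∈ kSets k n → edgesIn K T ≡ 0 ⊎ T ∈ K
  edgesIn≡0⊎∈ {T} T∈ with any? (_⊆? T) K
  ... | no ¬any = inj₁ (count-none (_⊆? T) (¬Any⇒All¬ K ¬any))
  ... | yes any with find any
  ...   | x , x∈K , x⊆T = inj₂ (subst (_∈ K) (p⊆q⇒∣p∣≡∣q∣⇒p≡q x⊆T ∣x∣≡∣T∣) x∈K)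
    where
    ∣x∣≡∣T∣ : ∣ x ∣ ≡ ∣ T ∣
    ∣x∣≡∣T∣ = trans (∈-kSets⁻ (Any-resp-⊆ K⊑ x∈K)) (sym (∈-kSets⁻ T∈))

even⇒∉ : ∀ {c} → c % 2 ≡ 0 → c ∉ 1 ∷ 3 ∷ []
even⇒∉ () (here refl)
even⇒∉ () (there (here refl))

1+b∉⇔odd : ∀ {b} → b ≤ 3 → (1 + b ∉ 1 ∷ 3 ∷ []) ⇔ (b % 2 ≡ 1)
1+b∉⇔odd {0} _ = mk⇔ (λ ∉ → contradiction (here refl) ∉) λ ()
1+b∉⇔odd {1} _ = mk⇔ (λ _ → refl) (λ _ → even⇒∉ refl)
1+b∉⇔odd {2} _ = mk⇔ (λ ∉ → contradiction (there (here refl)) ∉) λ ()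
1+b∉⇔odd {3} _ = mk⇔ (λ _ → refl) (λ _ → even⇒∉ refl)
1+b∉⇔odd {suc (suc (suc (suc _)))} (s≤s (s≤s (s≤s ())))

b∉⇔¬odd : ∀ {b} → b ≤ 3 → (b ∉ 1 ∷ 3 ∷ []) ⇔ (¬ b % 2 ≡ 1)
b∉⇔¬odd {0} _ = mk⇔ (λ _ ()) (λ _ → even⇒∉ refl)
b∉⇔¬odd {1} _ = mk⇔ (λ ∉ → contradiction (here refl) ∉) (λ ¬odd → contradiction refl ¬odd)
b∉⇔¬odd {2} _ = mk⇔ (λ _ ()) (λ _ → even⇒∉ refl)
b∉⇔¬odd {3} _ = mk⇔ (λ ∉ → contradiction (there (here refl)) ∉) (λ ¬odd → contradiction refl ¬odd)
b∉⇔¬odd {suc (suc (suc (suc _)))} (s≤s (s≤s (s≤s ())))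

addVertex : ∀ {n} → Hypergraph3 n → List (Subset n) → Hypergraph3 (suc n)
addVertex K G = map (outside ∷_) K ++ map (inside ∷_) G

module _ {n} (K G : List (Subset n)) where

  edgesIn-addVertex-outside : ∀ S → edgesIn (addVertex K G) (outside ∷ S) ≡ edgesIn K S
  edgesIn-addVertex-outside S = begin
    edgesIn (addVertex K G) (outside ∷ S)
      ≡⟨ count-++ (_⊆? outside ∷ S) (map (outside ∷_) K) _ ⟩
    edgesIn (map (outside ∷_) K) (outside ∷ S) + edgesIn (map (inside ∷_) G) (outside ∷ S)
      ≡⟨ cong₂ _+_ (trans (count-map _ (outside ∷_) K) (count-cong _ (_⊆? S) (λ _ → refl) K))
                   (trans (count-map _ (inside ∷_) G) (count-none _ (All.universal (λ _ → inside∷⊈outside∷) G))) ⟩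
    edgesIn K S + 0
      ≡⟨ +-identityʳ _ ⟩
    edgesIn K S
      ∎
    where open ≡-Reasoning

  edgesIn-addVertex-inside : ∀ S → edgesIn (addVertex K G) (inside ∷ S) ≡ edgesIn K S + edgesIn G S
  edgesIn-addVertex-inside S = trans (count-++ (_⊆? inside ∷ S) (map (outside ∷_) K) _)
    (cong₂ _+_ (trans (count-map _ (outside ∷_) K) (count-cong _ (_⊆? S) (λ _ → refl) K))
               (trans (count-map _ (inside ∷_) G) (count-cong _ (_⊆? S) (λ _ → refl) G)))

  avoids-addVertex⇔ : ∀ L → Avoids L (addVertex K G) ⇔ (Avoids L K × All (λ T → edgesIn K T + edgesIn G T ∉ L) (kSets 3 n))
  avoids-addVertex⇔ L = mk⇔ split join
    where
    split : Avoids L (addVertex K G) → Avoids L K × All (λ T → edgesIn K T + edgesIn G T ∉ L) (kSets 3 n)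
    split av with ++⁻ (map (outside ∷_) (kSets 4 n)) (subst (All _) (kSets-suc 3 n) av)
    ... | av₀ , av₁ = All.map (subst (_∉ L) (edgesIn-addVertex-outside _)) (map⁻ av₀)
                    , All.map (subst (_∉ L) (edgesIn-addVertex-inside _)) (map⁻ av₁)
    join : Avoids L K × All (λ T → edgesIn K T + edgesIn G T ∉ L) (kSets 3 n) → Avoids L (addVertex K G)
    join (avK , link) = subst (All _) (sym (kSets-suc 3 n))
      (++⁺ (map⁺ (All.map (subst (_∉ L) (sym (edgesIn-addVertex-outside _))) avK))
           (map⁺ (All.map (subst (_∉ L) (sym (edgesIn-addVertex-inside _))) link)))

oddTriples : ∀ {n} → List (Subset n) → Hypergraph3 n
oddTriples {n} G = filter (λ T → edgesIn G T % 2 ≟ 1) (kSets 3 n)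

module _ {n} {G : List (Subset n)} (G⊑ : G ⊑ kSets 2 n) where

  oddTriples-even : ∀ {S} → S ∈ kSets 4 n → edgesIn (oddTriples G) S % 2 ≡ 0
  oddTriples-even {S} S∈ = begin
    count (_⊆? S) (filter odd? (kSets 3 n)) % 2
      ≡⟨ cong (_% 2) (count-filter odd? (_⊆? S) (kSets 3 n)) ⟩
    count (λ T → odd? T ×-dec T ⊆? S) (kSets 3 n) % 2
      ≡⟨ cong (_% 2) (count-≐ (λ T → odd? T ×-dec T ⊆? S) (λ T → T ⊆? S ×-dec odd? T) (swap , swap) (kSets 3 n)) ⟩
    count (λ T → T ⊆? S ×-dec odd? T) (kSets 3 n) % 2
      ≡⟨ cong (_% 2) (count-filter (_⊆? S) odd? (kSets 3 n)) ⟨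
    count odd? triplesInS % 2
      ≡⟨ count-odd-%2 (edgesIn G) triplesInS ⟩
    sum (map (edgesIn G) triplesInS) % 2
      ≡⟨ cong (_% 2) (sum-count-comm (λ T g → g ⊆? T) triplesInS G) ⟩
    sum (map (λ g → count (g ⊆?_) triplesInS) G) % 2
      ≡⟨ sum-even (λ g → count (g ⊆?_) triplesInS) (All.tabulate (pair-in-even-many ∘ Any-resp-⊆ G⊑)) ⟩
    0
      ∎
    where
    open ≡-Reasoning
    odd? : ∀ T → Dec (edgesIn G T % 2 ≡ 1)
    odd? T = edgesIn G T % 2 ≟ 1
    triplesInS = filter (_⊆? S) (kSets 3 n)
    pair-in-even-many : ∀ {g} → g ∈ kSets 2 n → count (g ⊆?_) triplesInS % 2 ≡ 0
    pair-in-even-many {g} g∈ with g ⊆? S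
    ... | yes g⊆S = cong (_% 2) (subst₂ (λ a b → count (g ⊆?_) (filter (_⊆? S) (kSets (a + 1) n)) ≡ (b ∸ a) C 1)
                                        (∈-kSets⁻ g∈) (∈-kSets⁻ S∈) (count-kSets-between g⊆S 1))
    ... | no  g⊈S = cong (_% 2) (count-none (g ⊆?_) (All.tabulate λ T∈ g⊆T →
                      g⊈S (⊆-trans g⊆T (proj₂ (∈-filter⁻ (_⊆? S) {xs = kSets 3 n} T∈)))))

  oddTriples-avoids : Avoids (1 ∷ 3 ∷ []) (oddTriples G)
  oddTriples-avoids = All.tabulate (even⇒∉ ∘ oddTriples-even)

  link≤3 : ∀ {T} → T ∈ kSets 3 n → edgesIn G T ≤ 3
  link≤3 {T} T∈ = subst (λ m → edgesIn G T ≤ m C 2) (∈-kSets⁻ T∈) (edgesIn-⊑-kSets G⊑ T)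

  module _ {K : Hypergraph3 n} (K⊑ : K ⊑ kSets 3 n) where

    link-condition⇔ : ∀ {T} → T ∈ kSets 3 n →
                      (edgesIn K T + edgesIn G T ∉ 1 ∷ 3 ∷ []) ⇔ (T ∈ K ⇔ edgesIn G T % 2 ≡ 1)
    link-condition⇔ {T} T∈ with edgesIn≡0⊎∈ K⊑ T∈
    ... | inj₂ T∈K rewrite edgesIn-self K⊑ T∈K = ⇔-trans (1+b∉⇔odd (link≤3 T∈))
            (mk⇔ (λ odd → mk⇔ (λ _ → odd) (λ _ → T∈K)) (λ T∈K⇔odd → Equivalence.to T∈K⇔odd T∈K))
    ... | inj₁ none rewrite none = ⇔-trans (b∉⇔¬odd (link≤3 T∈))
            (mk⇔ (λ ¬odd → mk⇔ (λ T∈K → contradiction T∈K T∉K) (λ odd → contradiction odd ¬odd))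
                 (λ T∈K⇔odd odd → T∉K (Equivalence.from T∈K⇔odd odd)))
      where
      T∉K : T ∉ K
      T∉K T∈K = contradiction (trans (sym none) (edgesIn-self K⊑ T∈K)) λ ()

    link-conditions⇔ : All (λ T → edgesIn K T + edgesIn G T ∉ 1 ∷ 3 ∷ []) (kSets 3 n) ⇔ K ≡ oddTriples G
    link-conditions⇔ = mk⇔ determined satisfied
      where
      odd? : ∀ T → Dec (edgesIn G T % 2 ≡ 1)
      odd? T = edgesIn G T % 2 ≟ 1
      determined : All (λ T → edgesIn K T + edgesIn G T ∉ 1 ∷ 3 ∷ []) (kSets 3 n) → K ≡ oddTriples G
      determined link = ⊑-unique⇒≡filter odd? (kSets-unique 3 n) K⊑
        (λ T∈ → Equivalence.to (link-condition⇔ T∈) (All.lookup link T∈))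
      satisfied : K ≡ oddTriples G → All (λ T → edgesIn K T + edgesIn G T ∉ 1 ∷ 3 ∷ []) (kSets 3 n)
      satisfied refl = All.tabulate λ T∈ →
        Equivalence.from (link-condition⇔ T∈) (mk⇔ (proj₂ ∘ ∈-filter⁻ odd? {xs = kSets 3 n}) (∈-filter⁺ odd? T∈))

    avoids⇔≡oddTriples : Avoids (1 ∷ 3 ∷ []) (addVertex K G) ⇔ K ≡ oddTriples G
    avoids⇔≡oddTriples = mk⇔
      (Equivalence.to link-conditions⇔ ∘ proj₂ ∘ Equivalence.to (avoids-addVertex⇔ K G _))
      (λ K≡ → Equivalence.from (avoids-addVertex⇔ K G _)
                (subst (Avoids _) (sym K≡) oddTriples-avoids , Equivalence.from link-conditions⇔ K≡))

  count-avoiding-addVertex : count (λ K → avoids? (1 ∷ 3 ∷ []) (addVertex K G)) (sublists (kSets 3 n)) ≡ 1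
  count-avoiding-addVertex = count-sublists≡1 (λ K → avoids? _ (addVertex K G)) (λ T → edgesIn G T % 2 ≟ 1)
                                               (kSets-unique 3 n) avoids⇔≡oddTriples

f34-suc : ∀ n → f34 (suc n) (1 ∷ 3 ∷ []) ≡ 2 ^ (n C 2)
f34-suc n = begin
  count (avoids? L) (sublists (kSets 3 (suc n)))
    ≡⟨ cong (count (avoids? L) ∘ sublists) (kSets-suc 2 n) ⟩
  count (avoids? L) (sublists (map (outside ∷_) (kSets 3 n) ++ map (inside ∷_) (kSets 2 n)))
    ≡⟨ count-sublists-++-unique-prefix (avoids? L) (map (outside ∷_) (kSets 3 n)) (map (inside ∷_) (kSets 2 n)) unique-completion ⟩
  2 ^ length (map (inside ∷_) (kSets 2 n))
    ≡⟨ cong (2 ^_) (trans (length-map _ (kSets 2 n)) (length-kSets 2 n)) ⟩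
  2 ^ (n C 2)
    ∎
  where
  open ≡-Reasoning
  L = 1 ∷ 3 ∷ []
  unique-completion : ∀ {G′} → G′ ∈ sublists (map (inside ∷_) (kSets 2 n)) →
                      count (λ K′ → avoids? L (K′ ++ G′)) (sublists (map (outside ∷_) (kSets 3 n))) ≡ 1
  unique-completion {G′} G′∈ with ∈-map⁻ (map (inside ∷_)) (subst (G′ ∈_) (sublists-map (inside ∷_) (kSets 2 n)) G′∈)
  ... | G , G∈ , refl = begin
    count (λ K′ → avoids? L (K′ ++ map (inside ∷_) G)) (sublists (map (outside ∷_) (kSets 3 n)))
      ≡⟨ cong (count _) (sublists-map (outside ∷_) (kSets 3 n)) ⟩
    count (λ K′ → avoids? L (K′ ++ map (inside ∷_) G)) (map (map (outside ∷_)) (sublists (kSets 3 n)))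
      ≡⟨ count-map _ (map (outside ∷_)) (sublists (kSets 3 n)) ⟩
    count (λ K → avoids? L (addVertex K G)) (sublists (kSets 3 n))
      ≡⟨ count-avoiding-addVertex (∈-sublists⁻ G∈) ⟩
    1
      ∎

lemma4p4 : (n : ℕ) → 4 ≤ n → f34 n (1 ∷ 3 ∷ []) ≡ 2 ^ ((n ∸ 1) C 2)
lemma4p4 (suc n) _ = f34-suc n
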